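{- Let $\ell\geq 1$ be an integer and, for $\kappa\in\{1,\ldots,\ell+1\}$, let $A^{[\kappa]}\in M_\ell(\mathbb{R})$ be the matrix with entries \[ (A^{[\kappa]})_{ij}=\big((i-1)(\ell+1)+r^{[\kappa]}_j\big)^{\ell-1},\qquad 1\le i,j\le \ell, \] where $r^{[\kappa]}_j=j$ for $1\le j\le \kappa-1$ and $r^{[\kappa]}_j=j+1$ for $\kappa\le j\le \ell$. (Equivalently, $A^{[\kappa]}$ is obtained from the $\ell\times(\ell+1)$ matrix with entries $((i-1)(\ell+1)+j)^{\ell-1}$ by deleting the $\kappa$-th column.) Then there exists a number $\sigma_\ell$ depending only on $\ell$ such that for all $\kappa\in\{1,\ldots,\ell+1\}$, \[ \det(A^{[\kappa]})=(-1)^\ell\sigma_\ell\binom{\ell}{\kappa-1}. \]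
   Context: The convention $0^0=1$ is used. -}

module Defs where

open import Data.Nat as ℕ using (ℕ; zero; suc; _∸_; _≤ᵇ_)
open import Data.Fin using (Fin; zero; suc; toℕ; punchIn)
open import Data.Integer using (ℤ; +_; _+_; _*_; -_; _^_)
open import Data.Bool using (if_then_else_)
open import Data.Vec.Functional using (foldr)

Matrix : ℕ → Set
Matrix n = Fin n → Fin n → ℤ

∑ : ∀ {n} → (Fin n → ℤ) → ℤ
∑ f = foldr _+_ (+ 0) f

det : ∀ {n} → Matrix n → ℤ
det {zero}  M = + 1
det {suc n} M = ∑ λ j → ((- (+ 1)) ^ toℕ j) * (M zero j * det (λ a b → M (suc a) (punchIn j b)))

r : ℕ → ℕ → ℕ
r κ j = if j ≤ᵇ (κ ∸ 1) then j else suc j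

-- A^{[κ]} ∈ M_ℓ, entries ((i-1)(ℓ+1) + r^{[κ]}_j)^{ℓ-1}, with i, j 1-indexed
-- (the Fin index a corresponds to i = toℕ a + 1).
A : (ℓ κ : ℕ) → Matrix ℓ
A ℓ κ a b = + (((toℕ a ℕ.* suc ℓ) ℕ.+ r κ (suc (toℕ b))) ℕ.^ (ℓ ∸ 1))

-- Write V y for column y + 1 (y = 0, …, ℓ) of the ℓ × (ℓ + 1) matrix ((i - 1)(ℓ + 1) + j)^(ℓ - 1), so
-- that A^[c+1] consists of the columns V 0, …, V ℓ with V c deleted. Each row of V y is a polynomial of
-- degree ℓ - 1 in y, hence is killed by the ℓ-th finite difference: Σⱼ (-1)ʲ C(ℓ, j) V j = 0. Substituting
-- this combination for column k of A^[k+2] and expanding by multilinearity, every term except j = k and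
-- j = k + 1 has a repeated column, which leaves C(ℓ, k) det A^[k+2] = C(ℓ, k + 1) det A^[k+1]. By induction
-- det A^[c+1] = C(ℓ, c) det A^[1], and σ = (-1)^ℓ det A^[1].

module Submission where

open import Data.Nat as ℕ using (ℕ; zero; suc; _≤_; _∸_; s≤s)
import Data.Nat.Properties as ℕₚ
open import Data.Nat.Combinatorics using (_C_; nCk+nC[k+1]≡[n+1]C[k+1])
open import Data.Nat.Combinatorics.Specification using (k>n⇒nCk≡0)
open import Data.Fin using (Fin; zero; suc; toℕ; inject₁; punchIn; punchOut; fromℕ; fromℕ<; _≟_; _<_)
open import Data.Fin.Properties using (toℕ<n; toℕ-fromℕ<; toℕ-injective; toℕ-inject₁; toℕ-fromℕ; punchInᵢ≢i; punchIn-injective; punchIn-punchOut; <-cmp)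
open import Data.Fin.Induction using (<-weakInduction)
open import Data.Integer using (ℤ; +_; -_; _*_; _^_)
open import Data.Integer.Properties as ℤ using ()
open import Data.Integer.Tactic.RingSolver using (solve-∀)
open import Data.Bool.Properties using (if-float)
open import Data.Product using (Σ; ∃; _×_; _,_)
open import Function using (_∘_)
open import Relation.Binary.Definitions using (tri<; tri≈; tri>)
open import Relation.Binary.PropositionalEquality
open import Relation.Nullary using (Dec; yes; no; contradiction)
open import Defs
open ≡-Reasoning

punchIn-suc-self : ∀ {n} (i : Fin n) → punchIn (suc i) i ≡ inject₁ i
punchIn-suc-self zero    = refl
punchIn-suc-self (suc i) = cong suc (punchIn-suc-self i)

punchIn-inject₁-self : ∀ {n} (i : Fin n) → punchIn (inject₁ i) i ≡ suc i
punchIn-inject₁-self zero    = refl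
punchIn-inject₁-self (suc i) = cong suc (punchIn-inject₁-self i)

punchIn-inject₁≡punchIn-suc : ∀ {n} {i b : Fin n} → b ≢ i → punchIn (inject₁ i) b ≡ punchIn (suc i) b
punchIn-inject₁≡punchIn-suc {i = zero}  {zero}  0≢0 = contradiction refl 0≢0
punchIn-inject₁≡punchIn-suc {i = zero}  {suc b} _   = refl
punchIn-inject₁≡punchIn-suc {i = suc i} {zero}  _   = refl
punchIn-inject₁≡punchIn-suc {i = suc i} {suc b} b≢i = cong suc (punchIn-inject₁≡punchIn-suc (b≢i ∘ cong suc))

inject₁≢suc : ∀ {n} (i : Fin n) → inject₁ i ≢ suc i
inject₁≢suc i e = ℕₚ.1+n≢n (sym (trans (sym (toℕ-inject₁ i)) (cong toℕ e)))

punchIn-adjacent : ∀ {n} (j : Fin (suc (suc n))) (i : Fin (suc n)) → j ≢ inject₁ i → j ≢ suc i →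
                   ∃ λ (i′ : Fin n) → punchIn j (inject₁ i′) ≡ inject₁ i × punchIn j (suc i′) ≡ suc i
punchIn-adjacent         zero          zero    j≢i _     = contradiction refl j≢i
punchIn-adjacent         zero          (suc i) _   _     = i , refl , refl
punchIn-adjacent         (suc zero)    zero    _   j≢1+i = contradiction refl j≢1+i
punchIn-adjacent {suc n} (suc (suc j)) zero    _   _     = zero , refl , refl
punchIn-adjacent {suc n} (suc j)       (suc i) j≢i j≢1+i
  with i′ , e₁ , e₂ ← punchIn-adjacent j i (j≢i ∘ cong suc) (j≢1+i ∘ cong suc)
  = suc i′ , cong suc e₁ , cong suc e₂

nCk≢0 : ∀ {n k} → k ≤ n → n C k ≢ 0
nCk≢0 {n}     {zero}  _         ()
nCk≢0 {suc n} {suc k} (s≤s k≤n) nCk≡0 =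
  nCk≢0 k≤n (ℕₚ.m+n≡0⇒m≡0 (n C k) (trans (nCk+nC[k+1]≡[n+1]C[k+1] n k) nCk≡0))

r-punchIn : ∀ {n} (c : Fin (suc n)) (b : Fin n) → r (suc (toℕ c)) (suc (toℕ b)) ≡ suc (toℕ (punchIn c b))
r-punchIn zero    b       = refl
r-punchIn (suc c) zero    = refl
r-punchIn (suc c) (suc b) = trans (sym (if-float suc (suc (toℕ b) ℕ.≤ᵇ toℕ c))) (cong suc (r-punchIn c b))

-- Integer addition is opened only inside this block, so that _+_ in proposition3 is addition on ℕ.
module _ where
  open import Data.Integer using (_+_; _-_)
  open import Algebra.Properties.Semiring.Sum ℤ.+-*-semiring
    using (sum-cong-≗; ∑-distrib-+; *-distribˡ-sum; sum-remove; sum-replicate-zero; sum-init-last)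
  open import Algebra.Properties.AbelianGroup ℤ.+-0-abelianGroup using (inverseˡ-unique)

  Linear : {I : Set} → ((I → ℤ) → ℤ) → Set
  Linear L = ∀ {x y z} s t → (∀ a → x a ≡ s * y a + t * z a) → L x ≡ s * L y + t * L z

  Linear⇒additive : ∀ {I : Set} {L : (I → ℤ) → ℤ} → Linear L →
                    ∀ {x y z} → (∀ a → x a ≡ y a + z a) → L x ≡ L y + L z
  Linear⇒additive {L = L} lin {x} {y} {z} x≡ = begin
    L x                       ≡⟨ lin (+ 1) (+ 1) (λ a → trans (x≡ a) (sym (unit (y a) (z a)))) ⟩
    + 1 * L y + + 1 * L z     ≡⟨ unit (L y) (L z) ⟩
    L y + L z                 ∎
    where
    unit : ∀ a b → + 1 * a + + 1 * b ≡ a + b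
    unit = solve-∀

  ∑-linear : ∀ {n} → Linear (∑ {n})
  ∑-linear {x = x} {y} {z} s t x≡ = begin
    ∑ x                                     ≡⟨ sum-cong-≗ x≡ ⟩
    ∑ (λ a → s * y a + t * z a)             ≡⟨ ∑-distrib-+ (λ a → s * y a) (λ a → t * z a) ⟩
    ∑ (λ a → s * y a) + ∑ (λ a → t * z a)   ≡⟨ sym (cong₂ _+_ (*-distribˡ-sum s y) (*-distribˡ-sum t z)) ⟩
    s * ∑ y + t * ∑ z                       ∎

  ∑-support-one : ∀ {n} (t : Fin n → ℤ) p → (∀ j → j ≢ p → t j ≡ + 0) → ∑ t ≡ t p
  ∑-support-one {suc n} t p vanish = begin
    ∑ t                          ≡⟨ sum-remove {i = p} t ⟩
    t p + ∑ (t ∘ punchIn p)      ≡⟨ cong (λ u → t p + u) (sum-cong-≗ (λ j → vanish (punchIn p j) (punchInᵢ≢i p j))) ⟩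
    t p + ∑ {n} (λ _ → + 0)      ≡⟨ cong (λ u → t p + u) (sum-replicate-zero n) ⟩
    t p + + 0                    ≡⟨ ℤ.+-identityʳ (t p) ⟩
    t p                          ∎

  ∑-support-two : ∀ {n} (t : Fin n → ℤ) {p q} → p ≢ q → (∀ j → j ≢ p → j ≢ q → t j ≡ + 0) →
                  ∑ t ≡ t p + t q
  ∑-support-two {suc n} t {p} {q} p≢q vanish = begin
    ∑ t                                 ≡⟨ sum-remove {i = p} t ⟩
    t p + ∑ (t ∘ punchIn p)             ≡⟨ cong (λ u → t p + u) (∑-support-one (t ∘ punchIn p) (punchOut p≢q) vanish′) ⟩
    t p + t (punchIn p (punchOut p≢q))  ≡⟨ cong (λ j → t p + t j) (punchIn-punchOut p≢q) ⟩
    t p + t q                           ∎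
    where
    vanish′ : ∀ j → j ≢ punchOut p≢q → t (punchIn p j) ≡ + 0
    vanish′ j j≢ = vanish (punchIn p j) (punchInᵢ≢i p j)
      (λ e → j≢ (punchIn-injective p j _ (trans e (sym (punchIn-punchOut p≢q)))))

  infix 4 _≋_
  infixl 6 _[_]≔_

  _≋_ : ∀ {n} → Matrix n → Matrix n → Set
  M ≋ N = ∀ a b → M a b ≡ N a b

  sgn : ℕ → ℤ
  sgn k = (- (+ 1)) ^ k

  sgn*sgn≡1 : ∀ k → sgn k * sgn k ≡ + 1
  sgn*sgn≡1 zero    = refl
  sgn*sgn≡1 (suc k) = trans (square (sgn k)) (sgn*sgn≡1 k)
    where
    square : ∀ g → (- (+ 1)) * g * ((- (+ 1)) * g) ≡ g * g
    square = solve-∀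

  minor : ∀ {n} → Matrix (suc n) → Fin (suc n) → Matrix n
  minor M j a b = M (suc a) (punchIn j b)

  laplaceTerm : ∀ {n} → Matrix (suc n) → Fin (suc n) → ℤ
  laplaceTerm M j = sgn (toℕ j) * (M zero j * det (minor M j))

  det-cong : ∀ {n} {M N : Matrix n} → M ≋ N → det M ≡ det N
  det-cong {zero}  _   = refl
  det-cong {suc n} M≋N = sum-cong-≗ λ j →
    cong₂ (λ e d → sgn (toℕ j) * (e * d)) (M≋N zero j) (det-cong (λ a b → M≋N (suc a) (punchIn j b)))

  _[_]≔_ : ∀ {n} → Matrix n → Fin n → (Fin n → ℤ) → Matrix n
  (M [ p ]≔ x) a b with b ≟ p
  ... | yes _ = x a
  ... | no  _ = M a b

  []≔-updates : ∀ {n} (M : Matrix n) p x a → (M [ p ]≔ x) a p ≡ x a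
  []≔-updates M p x a with p ≟ p
  ... | yes _   = refl
  ... | no  p≢p = contradiction refl p≢p

  []≔-minimal : ∀ {n} (M : Matrix n) {p b} x a → b ≢ p → (M [ p ]≔ x) a b ≡ M a b
  []≔-minimal M {p} {b} x a b≢p with b ≟ p
  ... | yes b≡p = contradiction b≡p b≢p
  ... | no  _   = refl

  []≔-self : ∀ {n} (M : Matrix n) {p x} → (∀ a → x a ≡ M a p) → M [ p ]≔ x ≋ M
  []≔-self M {p} {x} x≡ a b with b ≟ p
  ... | yes refl = x≡ a
  ... | no  _    = refl

  []≔-comm : ∀ {n} (M : Matrix n) {p q} x y → p ≢ q → M [ p ]≔ x [ q ]≔ y ≋ M [ q ]≔ y [ p ]≔ x
  []≔-comm M {p} {q} x y p≢q a b with b ≟ q | b ≟ p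
  ... | yes refl | yes refl = contradiction refl p≢q
  ... | yes refl | no  _    = sym ([]≔-updates M q y a)
  ... | no  _    | yes refl = []≔-updates M p x a
  ... | no  b≢q  | no  b≢p  = trans ([]≔-minimal M x a b≢p) (sym ([]≔-minimal M y a b≢q))

  minor-[]≔-deleted : ∀ {n} (M : Matrix (suc n)) j x → minor (M [ j ]≔ x) j ≋ minor M j
  minor-[]≔-deleted M j x a b = []≔-minimal M x (suc a) (punchInᵢ≢i j b)

  minor-[]≔ : ∀ {n} (M : Matrix (suc n)) {j p} x (j≢p : j ≢ p) →
              minor (M [ p ]≔ x) j ≋ (minor M j [ punchOut j≢p ]≔ (x ∘ suc))
  minor-[]≔ M {j} {p} x j≢p a b with b ≟ punchOut j≢p
  ... | yes refl = trans (cong ((M [ p ]≔ x) (suc a)) (punchIn-punchOut j≢p)) ([]≔-updates M p x (suc a))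
  ... | no  b≢   = []≔-minimal M x (suc a) (λ e → b≢ (punchIn-injective j b _ (trans e (sym (punchIn-punchOut j≢p)))))

  det-linear : ∀ {n} (M : Matrix n) p → Linear (λ x → det (M [ p ]≔ x))
  det-linear {suc n} M p {x} {y} {z} s t x≡ = ∑-linear s t (λ j → term j (j ≟ p))
    where
    term : ∀ j → Dec (j ≡ p) →
           laplaceTerm (M [ p ]≔ x) j ≡ s * laplaceTerm (M [ p ]≔ y) j + t * laplaceTerm (M [ p ]≔ z) j
    term j (yes refl) = begin
      laplaceTerm (M [ j ]≔ x) j                           ≡⟨ expand x ⟩
      sgn (toℕ j) * (x zero * d)                           ≡⟨ cong (λ e → sgn (toℕ j) * (e * d)) (x≡ zero) ⟩
      sgn (toℕ j) * ((s * y zero + t * z zero) * d)        ≡⟨ distrib (sgn (toℕ j)) s t (y zero) (z zero) d ⟩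
      s * (sgn (toℕ j) * (y zero * d)) + t * (sgn (toℕ j) * (z zero * d))
                                                           ≡⟨ sym (cong₂ (λ u v → s * u + t * v) (expand y) (expand z)) ⟩
      s * laplaceTerm (M [ j ]≔ y) j + t * laplaceTerm (M [ j ]≔ z) j ∎
      where
      d = det (minor M j)
      distrib : ∀ g s t a b d → g * ((s * a + t * b) * d) ≡ s * (g * (a * d)) + t * (g * (b * d))
      distrib = solve-∀
      expand : ∀ w → laplaceTerm (M [ j ]≔ w) j ≡ sgn (toℕ j) * (w zero * d)
      expand w = cong₂ (λ e δ → sgn (toℕ j) * (e * δ)) ([]≔-updates M j w zero) (det-cong (minor-[]≔-deleted M j w))
    term j (no j≢p) = begin
      laplaceTerm (M [ p ]≔ x) j                            ≡⟨ expand x ⟩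
      sgn (toℕ j) * (M zero j * d x)                        ≡⟨ cong (λ e → sgn (toℕ j) * (M zero j * e)) (det-linear (minor M j) p′ s t (x≡ ∘ suc)) ⟩
      sgn (toℕ j) * (M zero j * (s * d y + t * d z))        ≡⟨ distrib (sgn (toℕ j)) (M zero j) s t (d y) (d z) ⟩
      s * (sgn (toℕ j) * (M zero j * d y)) + t * (sgn (toℕ j) * (M zero j * d z))
                                                            ≡⟨ sym (cong₂ (λ u v → s * u + t * v) (expand y) (expand z)) ⟩
      s * laplaceTerm (M [ p ]≔ y) j + t * laplaceTerm (M [ p ]≔ z) j ∎
      where
      p′ = punchOut j≢p
      distrib : ∀ g m s t a b → g * (m * (s * a + t * b)) ≡ s * (g * (m * a)) + t * (g * (m * b))
      distrib = solve-∀
      d : (Fin (suc n) → ℤ) → ℤ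
      d w = det (minor M j [ p′ ]≔ (w ∘ suc))
      expand : ∀ w → laplaceTerm (M [ p ]≔ w) j ≡ sgn (toℕ j) * (M zero j * d w)
      expand w = cong₂ (λ e δ → sgn (toℕ j) * (e * δ)) ([]≔-minimal M w zero j≢p) (det-cong (minor-[]≔ M w j≢p))

  det-zero-column : ∀ {n} (M : Matrix n) p {x} → (∀ a → x a ≡ + 0) → det (M [ p ]≔ x) ≡ + 0
  det-zero-column M p {x} x≡0 = det-linear M p {x} {x} {x} (+ 0) (+ 0) x≡0

  minor-adjacent : ∀ {n} (M : Matrix (suc n)) (i : Fin n) → (∀ a → M a (inject₁ i) ≡ M a (suc i)) →
                   minor M (inject₁ i) ≋ minor M (suc i)
  minor-adjacent M i col≡ a b with b ≟ i
  ... | yes refl = begin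
    M (suc a) (punchIn (inject₁ b) b) ≡⟨ cong (M (suc a)) (punchIn-inject₁-self b) ⟩
    M (suc a) (suc b)                 ≡⟨ sym (col≡ (suc a)) ⟩
    M (suc a) (inject₁ b)             ≡⟨ cong (M (suc a)) (sym (punchIn-suc-self b)) ⟩
    M (suc a) (punchIn (suc b) b)     ∎
  ... | no b≢i = cong (M (suc a)) (punchIn-inject₁≡punchIn-suc b≢i)

  det-equal-adjacent-columns : ∀ {n} (M : Matrix (suc n)) (i : Fin n) → (∀ a → M a (inject₁ i) ≡ M a (suc i)) →
                               det M ≡ + 0
  -- The minors at the two equal columns coincide, so their Laplace terms cancel.
  det-equal-adjacent-columns {suc n} M i col≡ = begin
    ∑ (laplaceTerm M)                                   ≡⟨ ∑-support-two (laplaceTerm M) (inject₁≢suc i) vanish ⟩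
    laplaceTerm M (inject₁ i) + laplaceTerm M (suc i)   ≡⟨ cong₂ (λ k e → sgn k * (e * d) + laplaceTerm M (suc i)) (toℕ-inject₁ i) (col≡ zero) ⟩
    sgn (toℕ i) * (m * d) + (- (+ 1)) * sgn (toℕ i) * (m * d′)
                                                        ≡⟨ cong (λ e → sgn (toℕ i) * (m * d) + (- (+ 1)) * sgn (toℕ i) * (m * e))
                                                                (det-cong (minor-adjacent M i col≡)) ⟨
    sgn (toℕ i) * (m * d) + (- (+ 1)) * sgn (toℕ i) * (m * d)
                                                        ≡⟨ cancel (sgn (toℕ i)) (m * d) ⟩
    + 0                                                 ∎
    where
    m  = M zero (suc i)
    d  = det (minor M (inject₁ i))
    d′ = det (minor M (suc i))
    cancel : ∀ g x → g * x + (- (+ 1)) * g * x ≡ + 0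
    cancel = solve-∀
    vanish : ∀ j → j ≢ inject₁ i → j ≢ suc i → laplaceTerm M j ≡ + 0
    vanish j j≢i j≢1+i with i′ , e₁ , e₂ ← punchIn-adjacent j i j≢i j≢1+i =
      begin
        sgn (toℕ j) * (M zero j * det (minor M j)) ≡⟨ cong (λ e → sgn (toℕ j) * (M zero j * e)) minor-singular ⟩
        sgn (toℕ j) * (M zero j * + 0)             ≡⟨ cong (sgn (toℕ j) *_) (ℤ.*-zeroʳ (M zero j)) ⟩
        sgn (toℕ j) * + 0                          ≡⟨ ℤ.*-zeroʳ (sgn (toℕ j)) ⟩
        + 0                                        ∎
      where
      minor-singular : det (minor M j) ≡ + 0
      minor-singular = det-equal-adjacent-columns (minor M j) i′ λ a → begin
        M (suc a) (punchIn j (inject₁ i′)) ≡⟨ cong (M (suc a)) e₁ ⟩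
        M (suc a) (inject₁ i)              ≡⟨ col≡ (suc a) ⟩
        M (suc a) (suc i)                  ≡⟨ cong (M (suc a)) (sym e₂) ⟩
        M (suc a) (punchIn j (suc i′))     ∎

  det-swap-adjacent-columns : ∀ {n} (M : Matrix (suc n)) (i : Fin n) u v →
    det (M [ inject₁ i ]≔ u [ suc i ]≔ v) ≡ - det (M [ inject₁ i ]≔ v [ suc i ]≔ u)
  det-swap-adjacent-columns M i u v = inverseˡ-unique (D u v) (D v u) (begin
    D u v + D v u                        ≡⟨ add-zeros (D u u) (D u v) (D v u) (D v v) (diagonal u) (diagonal v) ⟩
    (D u u + D u v) + (D v u + D v v)    ≡⟨ sym (cong₂ _+_ (additiveʳ u) (additiveʳ v)) ⟩
    D u w + D v w                        ≡⟨ sym additiveˡ ⟩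
    D w w                                ≡⟨ diagonal w ⟩
    + 0                                  ∎)
    where
    p = inject₁ i
    q = suc i
    D : (Fin _ → ℤ) → (Fin _ → ℤ) → ℤ
    D x y = det (M [ p ]≔ x [ q ]≔ y)
    w = λ a → u a + v a
    diagonal : ∀ x → D x x ≡ + 0
    diagonal x = det-equal-adjacent-columns (M [ p ]≔ x [ q ]≔ x) i λ a → begin
      (M [ p ]≔ x [ q ]≔ x) a p ≡⟨ []≔-minimal (M [ p ]≔ x) x a (inject₁≢suc i) ⟩
      (M [ p ]≔ x) a p          ≡⟨ []≔-updates M p x a ⟩
      x a                       ≡⟨ sym ([]≔-updates (M [ p ]≔ x) q x a) ⟩
      (M [ p ]≔ x [ q ]≔ x) a q ∎
    additiveʳ : ∀ x → D x w ≡ D x u + D x v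
    additiveʳ x = Linear⇒additive (det-linear (M [ p ]≔ x) q) (λ _ → refl)
    additiveˡ : D w w ≡ D u w + D v w
    additiveˡ = begin
      D w w                                    ≡⟨ commute w ⟩
      det (M [ q ]≔ w [ p ]≔ w)                ≡⟨ Linear⇒additive (det-linear (M [ q ]≔ w) p) (λ _ → refl) ⟩
      det (M [ q ]≔ w [ p ]≔ u) + det (M [ q ]≔ w [ p ]≔ v) ≡⟨ sym (cong₂ _+_ (commute u) (commute v)) ⟩
      D u w + D v w                            ∎
      where
      commute : ∀ x → D x w ≡ det (M [ q ]≔ w [ p ]≔ x)
      commute x = det-cong ([]≔-comm M x w (inject₁≢suc i))
    add-zeros : ∀ a b c d → a ≡ + 0 → d ≡ + 0 → b + c ≡ (a + b) + (c + d)
    add-zeros _ b c _ refl refl = identity b c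
      where
      identity : ∀ b c → b + c ≡ (+ 0 + b) + (c + + 0)
      identity = solve-∀

  det-equal-columns< : ∀ {n} (M : Matrix n) {p q} → p < q → (∀ a → M a p ≡ M a q) → det M ≡ + 0
  -- Induction on q: swapping the columns q - 1 and q moves the repeated column one step towards p.
  det-equal-columns< {suc n} M {p} {q} p<q col≡ = <-weakInduction Singular (λ _ ()) step q M p<q col≡
    where
    Singular : Fin (suc n) → Set
    Singular q = ∀ (M : Matrix (suc n)) {p} → p < q → (∀ a → M a p ≡ M a q) → det M ≡ + 0
    step : ∀ i → Singular (inject₁ i) → Singular (suc i)
    step i ih M {p} p<q col≡ with p ≟ inject₁ i
    ... | yes refl = det-equal-adjacent-columns M i col≡
    ... | no p≢i = begin
      det M                                       ≡⟨ det-cong ([]≔-self M {inject₁ i} (λ _ → refl)) ⟨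
      det (M [ inject₁ i ]≔ column (inject₁ i))   ≡⟨ det-cong ([]≔-self (M [ inject₁ i ]≔ column (inject₁ i)) {suc i}
                                                       (λ a → sym ([]≔-minimal M (column (inject₁ i)) a (inject₁≢suc i ∘ sym)))) ⟨
      det (M [ inject₁ i ]≔ column (inject₁ i) [ suc i ]≔ column (suc i))
                                                  ≡⟨ det-swap-adjacent-columns M i _ _ ⟩
      - det N                                     ≡⟨ cong -_ (ih N p<i col≡′) ⟩
      + 0                                         ∎
      where
      column : Fin (suc n) → Fin (suc n) → ℤ
      column b a = M a b
      N = M [ inject₁ i ]≔ column (suc i) [ suc i ]≔ column (inject₁ i)
      p<i : p < inject₁ i
      p<i = subst (toℕ p ℕ.<_) (sym (toℕ-inject₁ i))
              (ℕₚ.≤∧≢⇒< (ℕ.s≤s⁻¹ p<q) (λ e → p≢i (toℕ-injective (trans e (sym (toℕ-inject₁ i))))))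
      col≡′ : ∀ a → N a p ≡ N a (inject₁ i)
      col≡′ a = begin
        N a p                                            ≡⟨ []≔-minimal _ _ a (λ e → ℕₚ.<-irrefl (cong toℕ e) p<q) ⟩
        (M [ inject₁ i ]≔ column (suc i)) a p            ≡⟨ []≔-minimal M _ a p≢i ⟩
        M a p                                            ≡⟨ col≡ a ⟩
        M a (suc i)                                      ≡⟨ []≔-updates M (inject₁ i) (column (suc i)) a ⟨
        (M [ inject₁ i ]≔ column (suc i)) a (inject₁ i)  ≡⟨ []≔-minimal _ _ a (inject₁≢suc i) ⟨
        N a (inject₁ i)                                  ∎

  det-equal-columns : ∀ {n} (M : Matrix n) {p q} → p ≢ q → (∀ a → M a p ≡ M a q) → det M ≡ + 0
  det-equal-columns M {p} {q} p≢q col≡ with <-cmp p q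
  ... | tri< p<q _ _ = det-equal-columns< M p<q col≡
  ... | tri≈ _ p≡q _ = contradiction p≡q p≢q
  ... | tri> _ _ q<p = det-equal-columns< M q<p (sym ∘ col≡)

  ∇ : (ℕ → ℤ) → ℕ → ℤ
  ∇ f y = f y - f (suc y)

  ∇^ : ℕ → (ℕ → ℤ) → ℕ → ℤ
  ∇^ zero    f = f
  ∇^ (suc m) f = ∇^ m (∇ f)

  ∇^-cong : ∀ m {f g} → f ≗ g → ∇^ m f ≗ ∇^ m g
  ∇^-cong zero    f≗g = f≗g
  ∇^-cong (suc m) f≗g = ∇^-cong m (λ y → cong₂ _-_ (f≗g y) (f≗g (suc y)))

  ∇^-suc : ∀ m f y → ∇^ m (f ∘ suc) y ≡ ∇^ m f (suc y)
  ∇^-suc zero    f y = refl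
  ∇^-suc (suc m) f y = ∇^-suc m (∇ f) y

  ∇^-linear : ∀ {I : Set} {L : (I → ℤ) → ℤ} → Linear L →
              ∀ m (W : ℕ → I → ℤ) y → L (λ a → ∇^ m (λ z → W z a) y) ≡ ∇^ m (L ∘ W) y
  ∇^-linear lin zero    W y = refl
  ∇^-linear {L = L} lin (suc m) W y =
    trans (∇^-linear lin m (λ z a → W z a - W (suc z) a) y) (∇^-cong m L∘∇ y)
    where
    difference : ∀ a b → a - b ≡ + 1 * a + (- (+ 1)) * b
    difference = solve-∀
    L∘∇ : ∀ z → L (λ a → W z a - W (suc z) a) ≡ L (W z) - L (W (suc z))
    L∘∇ z = trans (lin (+ 1) (- (+ 1)) (λ a → difference (W z a) (W (suc z) a)))
                  (sym (difference (L (W z)) (L (W (suc z)))))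

  Degree< : ℕ → (ℕ → ℤ) → Set
  Degree< m f = ∀ y → ∇^ m f y ≡ + 0

  Degree<-cong : ∀ m {f g} → f ≗ g → Degree< m f → Degree< m g
  Degree<-cong m f≗g deg y = trans (sym (∇^-cong m f≗g y)) (deg y)

  Degree<-suc : ∀ m {f} → Degree< m f → Degree< m (f ∘ suc)
  Degree<-suc m {f} deg y = trans (∇^-suc m f y) (deg (suc y))

  Degree<-linear : ∀ m s t {f g} → Degree< m f → Degree< m g → Degree< m (λ y → s * f y + t * g y)
  Degree<-linear zero s t {f} {g} deg-f deg-g y =
    trans (cong₂ (λ u v → s * u + t * v) (deg-f y) (deg-g y)) (annihilate s t)
    where
    annihilate : ∀ s t → s * + 0 + t * + 0 ≡ + 0
    annihilate = solve-∀
  Degree<-linear (suc m) s t {f} {g} deg-f deg-g =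
    Degree<-cong m ∇-combination (Degree<-linear m s t deg-f deg-g)
    where
    distrib : ∀ s t a b c d → s * (a - c) + t * (b - d) ≡ (s * a + t * b) - (s * c + t * d)
    distrib = solve-∀
    ∇-combination : (λ y → s * ∇ f y + t * ∇ g y) ≗ ∇ (λ y → s * f y + t * g y)
    ∇-combination y = distrib s t (f y) (g y) (f (suc y)) (g (suc y))

  Degree<-*-linear : ∀ m c {f} → Degree< m f → Degree< (suc m) (λ y → + (c ℕ.+ y) * f y)
  Degree<-*-linear zero c {f} deg y =
    trans (cong₂ (λ u v → + (c ℕ.+ y) * u - + (c ℕ.+ suc y) * v) (deg y) (deg (suc y)))
          (annihilate (+ (c ℕ.+ y)) (+ (c ℕ.+ suc y)))
    where
    annihilate : ∀ a b → a * + 0 - b * + 0 ≡ + 0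
    annihilate = solve-∀
  Degree<-*-linear (suc m) c {f} deg =
    Degree<-cong (suc m) product-rule
      (Degree<-linear (suc m) (+ 1) (- (+ 1)) {λ y → + (c ℕ.+ y) * ∇ f y} {f ∘ suc}
        (Degree<-*-linear m c {∇ f} deg) (Degree<-suc (suc m) {f} deg))
    where
    rearrange : ∀ x u v → + 1 * (x * (u - v)) + (- (+ 1)) * v ≡ x * u - (+ 1 + x) * v
    rearrange = solve-∀
    product-rule : (λ y → + 1 * (+ (c ℕ.+ y) * ∇ f y) + (- (+ 1)) * f (suc y)) ≗ ∇ (λ y → + (c ℕ.+ y) * f y)
    product-rule y = begin
      + 1 * (+ (c ℕ.+ y) * ∇ f y) + (- (+ 1)) * f (suc y)   ≡⟨ rearrange (+ (c ℕ.+ y)) (f y) (f (suc y)) ⟩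
      + (c ℕ.+ y) * f y - (+ 1 + + (c ℕ.+ y)) * f (suc y)   ≡⟨ cong (λ k → + (c ℕ.+ y) * f y - k * f (suc y)) (sym (ℤ.pos-+ 1 (c ℕ.+ y))) ⟩
      + (c ℕ.+ y) * f y - + suc (c ℕ.+ y) * f (suc y)       ≡⟨ cong (λ k → + (c ℕ.+ y) * f y - + k * f (suc y)) (sym (ℕₚ.+-suc c y)) ⟩
      + (c ℕ.+ y) * f y - + (c ℕ.+ suc y) * f (suc y)       ∎

  Degree<-pow : ∀ d c → Degree< (suc d) (λ y → + ((c ℕ.+ y) ℕ.^ d))
  Degree<-pow zero    c y = refl
  Degree<-pow (suc d) c =
    Degree<-cong (suc (suc d)) (λ y → sym (ℤ.pos-* (c ℕ.+ y) ((c ℕ.+ y) ℕ.^ d)))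
      (Degree<-*-linear (suc d) c (Degree<-pow d c))

  signedBinomial : ℕ → ℕ → ℤ
  signedBinomial n j = sgn j * + (n C j)

  signedBinomial-pascal : ∀ n j →
    signedBinomial (suc n) (suc j) ≡ signedBinomial n (suc j) - signedBinomial n j
  signedBinomial-pascal n j = begin
    sgn (suc j) * + (suc n C suc j)              ≡⟨ cong (λ k → sgn (suc j) * + k) (sym (nCk+nC[k+1]≡[n+1]C[k+1] n j)) ⟩
    sgn (suc j) * + (n C j ℕ.+ n C suc j)        ≡⟨ cong (sgn (suc j) *_) (ℤ.pos-+ (n C j) (n C suc j)) ⟩
    (- (+ 1)) * sgn j * (+ (n C j) + + (n C suc j))
                                                 ≡⟨ distrib (sgn j) (+ (n C j)) (+ (n C suc j)) ⟩
    (- (+ 1)) * sgn j * + (n C suc j) - sgn j * + (n C j) ∎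
    where
    distrib : ∀ g a b → (- (+ 1)) * g * (a + b) ≡ (- (+ 1)) * g * b - g * a
    distrib = solve-∀

  signedBinomial[n,1+n]≡0 : ∀ n → signedBinomial n (suc n) ≡ + 0
  signedBinomial[n,1+n]≡0 n = trans (cong (λ k → sgn (suc n) * + k) (k>n⇒nCk≡0 (ℕₚ.n<1+n n))) (ℤ.*-zeroʳ (sgn (suc n)))

  ∇^-expansion : ∀ n f → ∇^ n f 0 ≡ ∑ λ (j : Fin (suc n)) → signedBinomial n (toℕ j) * f (toℕ j)
  ∇^-expansion zero    f = sym (trans (ℤ.+-identityʳ _) (ℤ.*-identityˡ (f 0)))
  ∇^-expansion (suc n) f = begin
    ∇^ n (∇ f) 0                                           ≡⟨ ∇^-expansion n (∇ f) ⟩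
    ∑ (λ (j : Fin (suc n)) → a (toℕ j) * (f (toℕ j) - f (suc (toℕ j))))
                                                           ≡⟨ ∑-linear {suc n} {y = λ j → a (toℕ j) * f (toℕ j)} (+ 1) (- (+ 1))
                                                                 (λ j → difference (a (toℕ j)) (f (toℕ j)) (f (suc (toℕ j)))) ⟩
    + 1 * (+ 1 * f 0 + inner) + (- (+ 1)) * shifted        ≡⟨ regroup (f 0) inner shifted ⟩
    + 1 * f 0 + (+ 1 * (inner + + 0) + (- (+ 1)) * shifted) ≡⟨ cong (λ w → + 1 * f 0 + (+ 1 * w + (- (+ 1)) * shifted)) (sym extended≡) ⟩
    + 1 * f 0 + (+ 1 * extended + (- (+ 1)) * shifted)     ≡⟨ cong (λ w → + 1 * f 0 + w) (sym (∑-linear {suc n} {y = λ j → a (suc (toℕ j)) * f (suc (toℕ j))}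
                                                                            {λ j → a (toℕ j) * f (suc (toℕ j))} (+ 1) (- (+ 1)) pascal)) ⟩
    + 1 * f 0 + ∑ (λ (j : Fin (suc n)) → signedBinomial (suc n) (suc (toℕ j)) * f (suc (toℕ j))) ∎
    where
    a = signedBinomial n
    inner    = ∑ λ (j : Fin n) → a (suc (toℕ j)) * f (suc (toℕ j))
    extended = ∑ λ (j : Fin (suc n)) → a (suc (toℕ j)) * f (suc (toℕ j))
    shifted  = ∑ λ (j : Fin (suc n)) → a (toℕ j) * f (suc (toℕ j))
    difference : ∀ c u v → c * (u - v) ≡ + 1 * (c * u) + (- (+ 1)) * (c * v)
    difference = solve-∀
    regroup : ∀ u w s → + 1 * (+ 1 * u + w) + (- (+ 1)) * s ≡ + 1 * u + (+ 1 * (w + + 0) + (- (+ 1)) * s)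
    regroup = solve-∀
    extended≡ : extended ≡ inner + + 0
    extended≡ = begin
      extended                                                          ≡⟨ sum-init-last {n} (λ j → a (suc (toℕ j)) * f (suc (toℕ j))) ⟩
      ∑ (λ (j : Fin n) → a (suc (toℕ (inject₁ j))) * f (suc (toℕ (inject₁ j)))) + a (suc (toℕ (fromℕ n))) * f (suc (toℕ (fromℕ n)))
        ≡⟨ cong₂ _+_ (sum-cong-≗ {n} λ j → cong (λ k → a (suc k) * f (suc k)) (toℕ-inject₁ j))
                     (trans (cong (λ k → a (suc k) * f (suc k)) (toℕ-fromℕ n)) (cong (_* f (suc n)) (signedBinomial[n,1+n]≡0 n))) ⟩
      inner + + 0                                                       ∎
    pascal : ∀ (j : Fin (suc n)) → signedBinomial (suc n) (suc (toℕ j)) * f (suc (toℕ j))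
                                   ≡ + 1 * (a (suc (toℕ j)) * f (suc (toℕ j))) + (- (+ 1)) * (a (toℕ j) * f (suc (toℕ j)))
    pascal j = trans (cong (_* f (suc (toℕ j))) (signedBinomial-pascal n (toℕ j))) (distrib (a (suc (toℕ j))) (a (toℕ j)) (f (suc (toℕ j))))
      where
      distrib : ∀ c d u → (c - d) * u ≡ + 1 * (c * u) + (- (+ 1)) * (d * u)
      distrib = solve-∀

  module _ {n} (V : ℕ → Fin n → ℤ) where

    columnsExcept : Fin (suc n) → Matrix n
    columnsExcept c a b = V (toℕ (punchIn c b)) a

    columnsExcept-relation : (∀ a → Degree< n (λ y → V y a)) → ∀ (k : Fin n) →
      signedBinomial n (toℕ k) * det (columnsExcept (suc k))
        + signedBinomial n (suc (toℕ k)) * det (columnsExcept (inject₁ k)) ≡ + 0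
    columnsExcept-relation degree k = begin
      a (toℕ k) * det M + a (suc (toℕ k)) * det M′       ≡⟨ cong₂ (λ u v → a (toℕ k) * u + a (suc (toℕ k)) * v) g-own g-next ⟨
      a (toℕ k) * g (toℕ k) + a (suc (toℕ k)) * g (suc (toℕ k))
                                                        ≡⟨ cong (λ i → a i * g i + a (suc (toℕ k)) * g (suc (toℕ k))) (toℕ-inject₁ k) ⟨
      a (toℕ (inject₁ k)) * g (toℕ (inject₁ k)) + a (suc (toℕ k)) * g (suc (toℕ k))
                                                        ≡⟨ ∑-support-two (λ j → a (toℕ j) * g (toℕ j)) (inject₁≢suc k)
                                                             (λ j j≢k j≢1+k → trans (cong (a (toℕ j) *_) (g-other j j≢k j≢1+k)) (ℤ.*-zeroʳ (a (toℕ j)))) ⟨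
      ∑ (λ (j : Fin (suc n)) → a (toℕ j) * g (toℕ j))   ≡⟨ ∇^-expansion n g ⟨
      ∇^ n g 0                                          ≡⟨ ∇^-linear (det-linear M k) n V 0 ⟨
      det (M [ k ]≔ λ b → ∇^ n (λ y → V y b) 0)         ≡⟨ det-zero-column M k (λ b → degree b 0) ⟩
      + 0                                               ∎
      where
      M  = columnsExcept (suc k)
      M′ = columnsExcept (inject₁ k)
      a = signedBinomial n
      g : ℕ → ℤ
      g y = det (M [ k ]≔ V y)
      g-own : g (toℕ k) ≡ det M
      g-own = det-cong ([]≔-self M λ b → cong (λ i → V i b) (sym (trans (cong toℕ (punchIn-suc-self k)) (toℕ-inject₁ k))))
      g-next : g (suc (toℕ k)) ≡ det M′
      g-next = det-cong λ b c → column-next b c (c ≟ k)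
        where
        column-next : ∀ b c → Dec (c ≡ k) → (M [ k ]≔ V (suc (toℕ k))) b c ≡ M′ b c
        column-next b c (yes refl) = trans ([]≔-updates M c _ b) (cong (λ i → V (toℕ i) b) (sym (punchIn-inject₁-self c)))
        column-next b c (no c≢k)   = trans ([]≔-minimal M _ b c≢k) (cong (λ i → V (toℕ i) b) (sym (punchIn-inject₁≡punchIn-suc c≢k)))
      g-other : ∀ j → j ≢ inject₁ k → j ≢ suc k → g (toℕ j) ≡ + 0
      g-other j j≢k j≢1+k = det-equal-columns (M [ k ]≔ V (toℕ j)) k≢q λ b → begin
        (M [ k ]≔ V (toℕ j)) b k ≡⟨ []≔-updates M k (V (toℕ j)) b ⟩
        V (toℕ j) b              ≡⟨ cong (λ i → V (toℕ i) b) (punchIn-punchOut (j≢1+k ∘ sym)) ⟨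
        M b q                    ≡⟨ []≔-minimal M (V (toℕ j)) b (k≢q ∘ sym) ⟨
        (M [ k ]≔ V (toℕ j)) b q ∎
        where
        q = punchOut (j≢1+k ∘ sym)
        k≢q : k ≢ q
        k≢q k≡q = j≢k (trans (sym (punchIn-punchOut (j≢1+k ∘ sym))) (trans (cong (punchIn (suc k)) (sym k≡q)) (punchIn-suc-self k)))

    columnsExcept-recurrence : (∀ a → Degree< n (λ y → V y a)) → ∀ (k : Fin n) →
      + (n C toℕ k) * det (columnsExcept (suc k)) ≡ + (n C suc (toℕ k)) * det (columnsExcept (inject₁ k))
    columnsExcept-recurrence degree k = ℤ.i-j≡0⇒i≡j _ _ (begin
      difference                                 ≡⟨ ℤ.*-identityˡ difference ⟨
      + 1 * difference                           ≡⟨ cong (_* difference) (sgn*sgn≡1 (toℕ k)) ⟨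
      sgn (toℕ k) * sgn (toℕ k) * difference     ≡⟨ factor (sgn (toℕ k)) (+ (n C toℕ k)) (+ (n C suc (toℕ k))) (det M) (det M′) ⟩
      sgn (toℕ k) * (signedBinomial n (toℕ k) * det M + signedBinomial n (suc (toℕ k)) * det M′)
                                                 ≡⟨ cong (sgn (toℕ k) *_) (columnsExcept-relation degree k) ⟩
      sgn (toℕ k) * + 0                          ≡⟨ ℤ.*-zeroʳ (sgn (toℕ k)) ⟩
      + 0                                        ∎)
      where
      M  = columnsExcept (suc k)
      M′ = columnsExcept (inject₁ k)
      difference = + (n C toℕ k) * det M - + (n C suc (toℕ k)) * det M′
      factor : ∀ s c c′ d d′ → s * s * (c * d - c′ * d′) ≡ s * (s * c * d + (- (+ 1)) * s * c′ * d′)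
      factor = solve-∀

    columnsExcept-binomial : (∀ a → Degree< n (λ y → V y a)) →
      ∀ c → det (columnsExcept c) ≡ + (n C toℕ c) * det (columnsExcept zero)
    columnsExcept-binomial degree = <-weakInduction Binomial (sym (ℤ.*-identityˡ E₀)) step
      where
      E₀ = det (columnsExcept zero)
      Binomial : Fin (suc n) → Set
      Binomial c = det (columnsExcept c) ≡ + (n C toℕ c) * E₀
      step : ∀ k → Binomial (inject₁ k) → Binomial (suc k)
      step k ih = ℤ.*-cancelˡ-≡ (+ (n C toℕ k)) _ _ {{ℕ.≢-nonZero (nCk≢0 (ℕₚ.<⇒≤ (toℕ<n k)))}} (begin
        + (n C toℕ k) * det (columnsExcept (suc k))                ≡⟨ columnsExcept-recurrence degree k ⟩
        + (n C suc (toℕ k)) * det (columnsExcept (inject₁ k))      ≡⟨ cong (+ (n C suc (toℕ k)) *_) ih ⟩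
        + (n C suc (toℕ k)) * (+ (n C toℕ (inject₁ k)) * E₀)       ≡⟨ cong (λ i → + (n C suc (toℕ k)) * (+ (n C i) * E₀)) (toℕ-inject₁ k) ⟩
        + (n C suc (toℕ k)) * (+ (n C toℕ k) * E₀)                 ≡⟨ swap (+ (n C suc (toℕ k))) (+ (n C toℕ k)) E₀ ⟩
        + (n C toℕ k) * (+ (n C suc (toℕ k)) * E₀)                 ∎)
        where
        swap : ∀ x y z → x * (y * z) ≡ y * (x * z)
        swap = solve-∀

open import Data.Nat using (_+_)

proposition3 : (ℓ : ℕ) → 1 ≤ ℓ →
    Σ ℤ λ σ → (κ : ℕ) → 1 ≤ κ → κ ≤ ℓ + 1 →
    det (A ℓ κ) ≡ ((- (+ 1)) ^ ℓ) * (σ * (+ (ℓ C (κ ∸ 1))))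
proposition3 ℓ@(suc d) _ = sgn ℓ * E₀ , formula
  where
  V : ℕ → Fin ℓ → ℤ
  V y a = + ((toℕ a ℕ.* suc ℓ + suc y) ℕ.^ d)
  E₀ = det (columnsExcept V zero)
  degree : ∀ a → Degree< ℓ (λ y → V y a)
  degree a = Degree<-suc ℓ {λ y → + ((toℕ a ℕ.* suc ℓ + y) ℕ.^ d)} (Degree<-pow d (toℕ a ℕ.* suc ℓ))
  formula-at : ∀ c → det (A ℓ (suc (toℕ c))) ≡ sgn ℓ * ((sgn ℓ * E₀) * + (ℓ C toℕ c))
  formula-at c = begin
    det (A ℓ (suc (toℕ c)))       ≡⟨ det-cong (λ a b → cong (λ i → + ((toℕ a ℕ.* suc ℓ + i) ℕ.^ d)) (r-punchIn c b)) ⟩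
    det (columnsExcept V c)       ≡⟨ columnsExcept-binomial V degree c ⟩
    + (ℓ C toℕ c) * E₀            ≡⟨ ℤ.*-identityˡ _ ⟨
    + 1 * (+ (ℓ C toℕ c) * E₀)    ≡⟨ cong (_* (+ (ℓ C toℕ c) * E₀)) (sgn*sgn≡1 ℓ) ⟨
    sgn ℓ * sgn ℓ * (+ (ℓ C toℕ c) * E₀) ≡⟨ rearrange (sgn ℓ) (+ (ℓ C toℕ c)) E₀ ⟩
    sgn ℓ * ((sgn ℓ * E₀) * + (ℓ C toℕ c)) ∎
    where
    rearrange : ∀ s c e → s * s * (c * e) ≡ s * ((s * e) * c)
    rearrange = solve-∀
  formula : (κ : ℕ) → 1 ≤ κ → κ ≤ ℓ + 1 → det (A ℓ κ) ≡ sgn ℓ * ((sgn ℓ * E₀) * + (ℓ C (κ ∸ 1)))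
  formula (suc k) _ (s≤s k≤ℓ) = subst (λ i → det (A ℓ (suc i)) ≡ sgn ℓ * ((sgn ℓ * E₀) * + (ℓ C i)))
    (toℕ-fromℕ< k<1+ℓ) (formula-at (fromℕ< k<1+ℓ))
    where
    k<1+ℓ : k ℕ.< suc ℓ
    k<1+ℓ = s≤s (subst (k ≤_) (ℕₚ.+-comm d 1) k≤ℓ)
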